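{- Let $E=\mathbb{Q}(\theta)$ be an algebraic number field of degree $n$ with the NC-property ($\theta$ an algebraic integer with minimal polynomial $\phi(x)=x^n-\phi_{n-1}x^{n-1}-\cdots-\phi_0\in\mathbb{Z}[x]$, and the ring of algebraic integers is $R=\mathbb{Z}[\theta]$). Let $\alpha,\beta\in R$ be nonzero and $A=\alpha\beta R$. Let $L_{\alpha,\beta}=L(H^*(\overline{\alpha}\otimes\overline{\beta}))$, let $B_{\alpha,\beta}$ be its basis in Hermite Normal Form with diagonal entries $b_1,\dots,b_n$, and let $$S_{\alpha,\beta}=\{(x_1,\dots,x_n)^T\in\mathbb{Z}^n\mid 0\le x_i<b_i,\ 1\le i\le n\}.$$ Then $\tau^{ -1}(S_{\alpha,\beta})$ is a complete set of coset representatives of the factor ring $R/A$ (every element of $R$ is congruent modulo $A$ to exactly one element of $\tau^{ -1}(S_{\alpha,\beta})$).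
   Context: $\tau:E\to\mathbb{Q}^n$ is $\sum_{i=0}^{n-1}a_i\theta^i\mapsto(a_0,\dots,a_{n-1})^T$, $\overline{\alpha}=\tau(\alpha)$. $H=H_\phi$ is the matrix whose first row is $(0,\dots,0,\phi_0)$ and whose lower $(n-1)\times n$ block is $[\,I_{n-1}\mid (\phi_1,\dots,\phi_{n-1})^T\,]$; $H^*(\overline{f})=[\overline{f},H\overline{f},\dots,H^{n-1}\overline{f}]$ (columns listed); $\overline{f}\otimes\overline{g}=H^*(\overline{f})\overline{g}$; $L(B)=\{Bx\mid x\in\mathbb{Z}^n\}$. A basis matrix $B=(b_{ij})$ of an integer lattice is in Hermite Normal Form if it is upper triangular, its diagonal entries are strictly positive, and every other entry satisfies $0\le b_{ij}<b_{ii}$; every full-rank integer lattice has a unique such basis. -}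

module Defs where

open import Data.Nat as ℕ using (ℕ; zero; suc; _∸_; _<ᵇ_; _≡ᵇ_)
open import Data.Fin using (Fin; zero; suc; toℕ)
open import Data.Bool using (if_then_else_)
open import Data.Integer as ℤ using (ℤ)
open import Data.Rational as ℚ using (ℚ)
open import Data.Product using (Σ; ∃; ∃-syntax; _×_)
open import Relation.Nullary using (¬_)
open import Relation.Binary.PropositionalEquality using (_≡_; _≢_)
open import Function.Bundles using (_⇔_)

-- Generic linear algebra over a carrier with 0, 1, +, *
-- Vectors are functions Fin n → A, matrices are Fin n → Fin n → A
-- (M i j = entry in row i, column j).  Index i : Fin n corresponds to the
-- paper's index i+1 (coordinates a_0..a_{n-1}).

module Alg {A : Set} (0# 1# : A) (_+_ _*_ : A → A → A) where

  Σ[_] : ∀ n → (Fin n → A) → A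
  Σ[ zero ] f = 0#
  Σ[ suc n ] f = f zero + Σ[ n ] (λ i → f (suc i))

  _·_ : ∀ {n} → (Fin n → Fin n → A) → (Fin n → A) → (Fin n → A)
  (_·_ {n} M x) i = Σ[ n ] (λ j → M i j * x j)

  -- H_φ for degree n = suc m, with φ i = φ_i (i = 0..n-1):
  -- first row (0,…,0,φ_0); rows 1..n-1 are [ I_{n-1} | (φ_1,…,φ_{n-1})^T ].
  H : ∀ {m} → (Fin (suc m) → A) → Fin (suc m) → Fin (suc m) → A
  H {m} φ i j =
    if toℕ j ≡ᵇ m then φ i
    else (if suc (toℕ j) ≡ᵇ toℕ i then 1# else 0#)

  iter : ∀ {B : Set} → ℕ → (B → B) → B → B
  iter zero g b = b
  iter (suc k) g b = g (iter k g b)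

  H* : ∀ {m} → (Fin (suc m) → A) → (Fin (suc m) → A) → Fin (suc m) → Fin (suc m) → A
  H* φ f i j = iter (toℕ j) (H φ ·_) f i

  mul : ∀ {m} → (Fin (suc m) → A) → (Fin (suc m) → A) → (Fin (suc m) → A) → (Fin (suc m) → A)
  mul φ f g = H* φ f · g

  one : ∀ {m} → Fin (suc m) → A
  one zero = 1#
  one (suc _) = 0#

  pow : ∀ {m} → (Fin (suc m) → A) → (Fin (suc m) → A) → ℕ → (Fin (suc m) → A)
  pow φ e k = iter k (mul φ e) one

  monicCoeff : ∀ d → (Fin d → A) → ℕ → A
  monicCoeff zero c zero = 1#
  monicCoeff zero c (suc k) = 0#
  monicCoeff (suc d) c zero = c zero
  monicCoeff (suc d) c (suc k) = monicCoeff d (λ i → c (suc i)) k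

  prodCoeff : (ℕ → A) → (ℕ → A) → ℕ → A
  prodCoeff a b k = Σ[ suc k ] (λ i → a (toℕ i) * b (k ∸ toℕ i))

module Zalg = Alg (ℤ.+ 0) (ℤ.+ 1) ℤ._+_ ℤ._*_
module Qalg = Alg ℚ.0ℚ ℚ.1ℚ ℚ._+_ ℚ._*_

open Zalg public using (_·_; H; H*; mul)

toℚ : ℤ → ℚ
toℚ z = z ℚ./ 1

-- The defining polynomial φ(x) = x^n − φ_{n-1}x^{n-1} − ⋯ − φ_0, n = suc m,
-- given by its coefficient vector (φ_0,…,φ_{n-1}) ∈ ℤ^n.

φcoeffℚ : ∀ {m} → (Fin (suc m) → ℤ) → ℕ → ℚ
φcoeffℚ {m} φ = Qalg.monicCoeff (suc m) (λ i → ℚ.- toℚ (φ i))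

-- φ is irreducible over ℚ (so it is the minimal polynomial of θ and
-- E = ℚ[x]/(φ) is a number field of degree n): φ is not a product of two
-- (w.l.o.g. monic) rational polynomials of positive degree.
IrreducibleQ : ∀ {m} → (Fin (suc m) → ℤ) → Set
IrreducibleQ φ =
  ∀ d e (g : Fin (suc d) → ℚ) (h : Fin (suc e) → ℚ) →
  ¬ (∀ k → Qalg.prodCoeff (Qalg.monicCoeff (suc d) g) (Qalg.monicCoeff (suc e) h) k
           ≡ φcoeffℚ φ k)

-- E = ℚ^n with multiplication ⊗ (over ℚ); evaluation of the monic integer
-- polynomial x^d + Σ_{k<d} c_k x^k at e ∈ E
evalMonic : ∀ {m} → (Fin (suc m) → ℤ) → (d : ℕ) → (Fin d → ℤ) →
            (Fin (suc m) → ℚ) → (Fin (suc m) → ℚ)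
evalMonic {m} φ d c e i =
  Qalg.pow φq e d i ℚ.+ Qalg.Σ[ d ] (λ k → toℚ (c k) ℚ.* Qalg.pow φq e (toℕ k) i)
  where φq = λ j → toℚ (φ j)

-- NC-property: the ring of algebraic integers of E is ℤ[θ], i.e. every
-- element of E that is a root of a monic integer polynomial has integer
-- coordinates in the power basis 1, θ, …, θ^{n-1}.
NCProperty : ∀ {m} → (Fin (suc m) → ℤ) → Set
NCProperty {m} φ =
  ∀ (e : Fin (suc m) → ℚ) (d : ℕ) (c : Fin d → ℤ) →
  (∀ i → evalMonic φ d c e i ≡ ℚ.0ℚ) →
  ∀ i → ∃[ z ] (e i ≡ toℚ z)

NonZeroVec : ∀ {n} → (Fin n → ℤ) → Set
NonZeroVec v = ¬ (∀ i → v i ≡ ℤ.+ 0)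

_∈L_ : ∀ {n} → (Fin n → ℤ) → (Fin n → Fin n → ℤ) → Set
_∈L_ {n} v M = ∃[ x ] (∀ i → v i ≡ Zalg._·_ M x i)

IsHNF : ∀ {n} → (Fin n → Fin n → ℤ) → Set
IsHNF {n} B =
  (∀ (i j : Fin n) → toℕ j ℕ.< toℕ i → B i j ≡ ℤ.+ 0)
  × (∀ i → ℤ.+ 0 ℤ.< B i i)
  × (∀ i j → i ≢ j → (ℤ.+ 0 ℤ.≤ B i j) × (B i j ℤ.< B i i))

IsBasisOf : ∀ {n} → (Fin n → Fin n → ℤ) → (Fin n → Fin n → ℤ) → Set
IsBasisOf B M = ∀ v → (v ∈L B) ⇔ (v ∈L M)

_∈S_ : ∀ {n} → (Fin n → ℤ) → (Fin n → Fin n → ℤ) → Set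
x ∈S B = ∀ i → (ℤ.+ 0 ℤ.≤ x i) × (x i ℤ.< B i i)

-- r ≡ s (mod A), A = αβR:  r − s = (αβ)ρ for some ρ ∈ R, in coordinates
-- τ(r) − τ(s) = (ᾱ ⊗ β̄) ⊗ ρ̄
CongModA : ∀ {m} → (φ α β : Fin (suc m) → ℤ) → (r s : Fin (suc m) → ℤ) → Set
CongModA φ α β r s = ∃[ ρ ] (∀ i → r i ℤ.- s i ≡ mul φ (mul φ α β) ρ i)

{-# OPTIONS --safe #-}
-- Only the lattice L = L(B) matters: x ⊗ ρ = H*(x) ρ, so r ≡ s (mod αβR) says exactly that
-- r − s ∈ L(H*(ᾱ ⊗ β̄)) = L(B). Since B is upper triangular with positive diagonal b₁,…,bₙ,
-- the box S is a fundamental domain of ℤⁿ/L. Reduce the last coordinate modulo bₙ using the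
-- last column, then proceed upwards: column i of B only touches rows 1,…,i.
-- Conversely, if s, s′ ∈ S and s − s′ = B d, back substitution from the last row gives
-- |bᵢ dᵢ| = |sᵢ − s′ᵢ| < bᵢ, so every dᵢ = 0.
module Submission where

open import Defs
open import Data.Nat using (ℕ; suc)
open import Data.Fin using (Fin)
open import Data.Integer using (ℤ)
open import Data.Product using (∃-syntax; _×_)
open import Relation.Binary.PropositionalEquality using (_≡_)

import Data.Nat as ℕ
import Data.Nat.Properties as ℕ
open import Data.Fin using (zero; suc; toℕ)
open import Data.Integer using (+_; _+_; _*_; _-_; _<_; _≤_; _⊖_; ∣_∣; +<+; +≤+; NonZero; >-nonZero)
open import Data.Integer.Properties
  using (abs-*; ∣i∣≡0⇒i≡0; ∣m⊝n∣≤m⊔n; [+m]-[+n]≡m⊖n; *-zeroʳ; +-identityˡ; +-identityʳ;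
         i-j≡0⇒i≡j; 0≤i⇒+∣i∣≡i; <⇒≤)
open import Data.Integer.DivMod using (_/_; _%_; n%d<d; a≡a%n+[a/n]*n)
open import Data.Integer.Solver using (module +-*-Solver)
open import Data.Product using (_,_; proj₁; proj₂)
open import Function.Bundles using (Equivalence)
open import Relation.Binary.PropositionalEquality
  using (refl; sym; trans; cong; cong₂; subst; module ≡-Reasoning)

open +-*-Solver
open Zalg using (Σ[_])

Σ-cong : ∀ n {f g : Fin n → ℤ} → (∀ i → f i ≡ g i) → Σ[ n ] f ≡ Σ[ n ] g
Σ-cong ℕ.zero  f≗g = refl
Σ-cong (suc n) f≗g = cong₂ _+_ (f≗g zero) (Σ-cong n (λ i → f≗g (suc i)))

Σ-*-≡0 : ∀ n (c : Fin n → ℤ) {d : Fin n → ℤ} → (∀ i → d i ≡ + 0) →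
         Σ[ n ] (λ i → c i * d i) ≡ + 0
Σ-*-≡0 ℕ.zero  c d≡0 = refl
Σ-*-≡0 (suc n) c d≡0 =
  cong₂ _+_ (trans (cong (c zero *_) (d≡0 zero)) (*-zeroʳ (c zero)))
            (Σ-*-≡0 n (λ i → c (suc i)) (λ i → d≡0 (suc i)))

Σ-distrib-- : ∀ n (f g : Fin n → ℤ) → Σ[ n ] f - Σ[ n ] g ≡ Σ[ n ] (λ i → f i - g i)
Σ-distrib-- ℕ.zero  f g = refl
Σ-distrib-- (suc n) f g = begin
  (f zero + F) - (g zero + G)
    ≡⟨ solve 4 (λ a b c d → (a :+ c) :- (b :+ d) := (a :- b) :+ (c :- d)) refl (f zero) (g zero) F G ⟩
  (f zero - g zero) + (F - G)
    ≡⟨ cong (λ h → (f zero - g zero) + h) (Σ-distrib-- n (λ i → f (suc i)) (λ i → g (suc i))) ⟩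
  (f zero - g zero) + Σ[ n ] (λ i → f (suc i) - g (suc i))
    ∎
  where
  open ≡-Reasoning
  F G : ℤ
  F = Σ[ n ] (λ i → f (suc i))
  G = Σ[ n ] (λ i → g (suc i))

∈L-resp-≗ : ∀ {n} {B : Fin n → Fin n → ℤ} {u v : Fin n → ℤ} →
            (∀ i → u i ≡ v i) → u ∈L B → v ∈L B
∈L-resp-≗ u≗v (x , u≡Bx) = x , λ i → trans (sym (u≗v i)) (u≡Bx i)

∈L-sub : ∀ {n} {B : Fin n → Fin n → ℤ} {u v : Fin n → ℤ} →
         u ∈L B → v ∈L B → (λ i → u i - v i) ∈L B
∈L-sub {n} {B} {u} {v} (x , u≡Bx) (y , v≡By) = (λ j → x j - y j) , λ i → begin
  u i - v i                                 ≡⟨ cong₂ _-_ (u≡Bx i) (v≡By i) ⟩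
  (B · x) i - (B · y) i                     ≡⟨ Σ-distrib-- n _ _ ⟩
  Σ[ n ] (λ j → B i j * x j - B i j * y j)  ≡⟨ Σ-cong n (λ j → *-distribˡ-- (B i j) (x j) (y j)) ⟩
  (B · (λ j → x j - y j)) i                 ∎
  where
  open ≡-Reasoning
  *-distribˡ-- : ∀ b p q → b * p - b * q ≡ b * (p - q)
  *-distribˡ-- = solve 3 (λ b p q → b :* p :- b :* q := b :* (p :- q)) refl

UpperTriangular⁺ : ∀ {n} → (Fin n → Fin n → ℤ) → Set
UpperTriangular⁺ {n} B =
  (∀ (i j : Fin n) → toℕ j ℕ.< toℕ i → B i j ≡ + 0) × (∀ i → + 0 < B i i)

lowerRight : ∀ {n} → (Fin (suc n) → Fin (suc n) → ℤ) → Fin n → Fin n → ℤ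
lowerRight B i j = B (suc i) (suc j)

lowerRight-upperTriangular⁺ : ∀ {n} {B : Fin (suc n) → Fin (suc n) → ℤ} →
                              UpperTriangular⁺ B → UpperTriangular⁺ (lowerRight B)
lowerRight-upperTriangular⁺ (lower≡0 , diag>0) =
  (λ i j j<i → lower≡0 (suc i) (suc j) (ℕ.s≤s j<i)) , (λ i → diag>0 (suc i))

·-suc : ∀ {n} {B : Fin (suc n) → Fin (suc n) → ℤ} → UpperTriangular⁺ B →
        ∀ x i → (B · x) (suc i) ≡ (lowerRight B · (λ j → x (suc j))) i
·-suc {n} {B} (lower≡0 , _) x i =
  trans (cong (λ b → b * x zero + rest) (lower≡0 (suc i) zero (ℕ.s≤s ℕ.z≤n))) (+-identityˡ rest)
  where
  rest : ℤ
  rest = Σ[ n ] (λ j → B (suc i) (suc j) * x (suc j))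

residue-difference≡0 : ∀ {s s′ b} (k : ℤ) → + 0 ≤ s → s < b → + 0 ≤ s′ → s′ < b →
                       s - s′ ≡ b * k → k ≡ + 0
residue-difference≡0 {+ p} {+ q} {+ b} k (+≤+ _) (+<+ p<b) (+≤+ _) (+<+ q<b) p-q≡bk =
  ∣i∣≡0⇒i≡0 (ℕ.n<1⇒n≡0 (ℕ.*-cancelˡ-< b ∣ k ∣ 1 b∣k∣<b*1))
  where
  open ℕ.≤-Reasoning
  b∣k∣<b*1 : b ℕ.* ∣ k ∣ ℕ.< b ℕ.* 1
  b∣k∣<b*1 = begin-strict
    b ℕ.* ∣ k ∣    ≡⟨ abs-* (+ b) k ⟨
    ∣ + b * k ∣    ≡⟨ cong ∣_∣ p-q≡bk ⟨
    ∣ + p - + q ∣  ≡⟨ cong ∣_∣ ([+m]-[+n]≡m⊖n p q) ⟩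
    ∣ p ⊖ q ∣      ≤⟨ ∣m⊝n∣≤m⊔n p q ⟩
    p ℕ.⊔ q        <⟨ ℕ.⊔-lub p<b q<b ⟩
    b              ≡⟨ ℕ.*-identityʳ b ⟨
    b ℕ.* 1        ∎

∈S-representative : ∀ n {B : Fin n → Fin n → ℤ} → UpperTriangular⁺ B → (r : Fin n → ℤ) →
                    ∃[ s ] (s ∈S B × (λ i → r i - s i) ∈L B)
∈S-representative ℕ.zero    _ r = (λ ()) , (λ ()) , (λ ()) , (λ ())
∈S-representative (suc n) {B} tri@(_ , diag>0) r
  with ∈S-representative n (lowerRight-upperTriangular⁺ tri) (λ i → r (suc i))
... | s′ , s′∈S , x′ , r′-s′≡B′x′ = s , s∈S , x , r-s≡Bx
  where
  b : ℤ
  b = B zero zero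
  instance
    b≢0 : NonZero b
    b≢0 = >-nonZero (diag>0 zero)
  S t : ℤ
  S = Σ[ n ] (λ j → B zero (suc j) * x′ j)
  t = r zero - S
  s x : Fin (suc n) → ℤ
  s zero    = + (t % b)
  s (suc i) = s′ i
  x zero    = t / b
  x (suc i) = x′ i
  s∈S : s ∈S B
  s∈S zero    = +≤+ ℕ.z≤n , subst (s zero <_) (0≤i⇒+∣i∣≡i (<⇒≤ (diag>0 zero))) (+<+ (n%d<d t b))
  s∈S (suc i) = s′∈S i
  r-s≡Bx : ∀ i → r i - s i ≡ (B · x) i
  r-s≡Bx zero = begin
    r zero - s zero
      ≡⟨ solve 3 (λ r s S → r :- s := ((r :- S) :- s) :+ S) refl (r zero) (s zero) S ⟩
    (t - s zero) + S
      ≡⟨ cong (λ u → (u - s zero) + S) (a≡a%n+[a/n]*n t b) ⟩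
    (s zero + x zero * b) - s zero + S
      ≡⟨ solve 4 (λ s x b S → s :+ x :* b :- s :+ S := b :* x :+ S) refl (s zero) (x zero) b S ⟩
    (B · x) zero
      ∎
    where open ≡-Reasoning
  r-s≡Bx (suc i) = trans (r′-s′≡B′x′ i) (sym (·-suc tri x i))

s-s′≡Bd⇒d≡0 : ∀ n {B : Fin n → Fin n → ℤ} → UpperTriangular⁺ B → {s s′ d : Fin n → ℤ} →
              s ∈S B → s′ ∈S B → (∀ i → s i - s′ i ≡ (B · d) i) → ∀ i → d i ≡ + 0
s-s′≡Bd⇒d≡0 ℕ.zero    _ _ _ _ ()
s-s′≡Bd⇒d≡0 (suc n) {B} tri {s} {s′} {d} s∈S s′∈S s-s′≡Bd = d≡0
  where
  d′≡0 : ∀ i → d (suc i) ≡ + 0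
  d′≡0 = s-s′≡Bd⇒d≡0 n (lowerRight-upperTriangular⁺ tri) (λ i → s∈S (suc i)) (λ i → s′∈S (suc i))
           (λ i → trans (s-s′≡Bd (suc i)) (·-suc tri d i))
  top-row : s zero - s′ zero ≡ B zero zero * d zero
  top-row = begin
    s zero - s′ zero
      ≡⟨ s-s′≡Bd zero ⟩
    B zero zero * d zero + Σ[ n ] (λ j → B zero (suc j) * d (suc j))
      ≡⟨ cong (λ h → B zero zero * d zero + h) (Σ-*-≡0 n (λ j → B zero (suc j)) d′≡0) ⟩
    B zero zero * d zero + + 0
      ≡⟨ +-identityʳ _ ⟩
    B zero zero * d zero
      ∎
    where open ≡-Reasoning
  d≡0 : ∀ i → d i ≡ + 0
  d≡0 zero    = residue-difference≡0 (d zero) (proj₁ (s∈S zero)) (proj₂ (s∈S zero))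
                  (proj₁ (s′∈S zero)) (proj₂ (s′∈S zero)) top-row
  d≡0 (suc i) = d′≡0 i

∈S-unique : ∀ n {B : Fin n → Fin n → ℤ} → UpperTriangular⁺ B → {r s s′ : Fin n → ℤ} →
            s ∈S B → s′ ∈S B → (λ i → r i - s i) ∈L B → (λ i → r i - s′ i) ∈L B →
            ∀ i → s′ i ≡ s i
∈S-unique n {B} tri {r} {s} {s′} s∈S s′∈S r-s∈L r-s′∈L
  with ∈L-resp-≗ {B = B} (λ i → solve 3 (λ r s s′ → (r :- s) :- (r :- s′) := s′ :- s) refl (r i) (s i) (s′ i))
                 (∈L-sub {B = B} r-s∈L r-s′∈L)
... | d , s′-s≡Bd = λ i →
  i-j≡0⇒i≡j _ _ (trans (s′-s≡Bd i) (Σ-*-≡0 n (B i) (s-s′≡Bd⇒d≡0 n tri {d = d} s′∈S s∈S s′-s≡Bd)))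

lemma3p2 : (m : ℕ) (φ : Fin (suc m) → ℤ) →
    IrreducibleQ φ → NCProperty φ →
    (α β : Fin (suc m) → ℤ) → NonZeroVec α → NonZeroVec β →
    (B : Fin (suc m) → Fin (suc m) → ℤ) →
    IsHNF B → IsBasisOf B (H* φ (mul φ α β)) →
    ∀ (r : Fin (suc m) → ℤ) →
      ∃[ s ] ((s ∈S B) × CongModA φ α β r s
        × (∀ s′ → s′ ∈S B → CongModA φ α β r s′ → ∀ i → s′ i ≡ s i))
lemma3p2 m φ _ _ α β _ _ B (lower≡0 , diag>0 , _) basis r
  with ∈S-representative (suc m) (lower≡0 , diag>0) r
... | s , s∈S , r-s∈L =
  s , s∈S , Equivalence.to (basis _) r-s∈L ,
  λ s′ s′∈S r≡s′ →
    ∈S-unique (suc m) (lower≡0 , diag>0) {r} s∈S s′∈S r-s∈L (Equivalence.from (basis _) r≡s′)
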